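{- Let $T$ be a labeled rooted tree with $n$ vertices. Then $$\sum_{T_0 \to T} {T \choose T_0} = 2^n,$$ where the sum is over all rooted subtrees $T_0$ of $T$, including the empty subtree, and $${T\choose T_0} = \frac{T!}{T_0!\,\prod_{T'\in T\setminus T_0} T'!}.$$
   Context: A labeled rooted tree on a non-empty finite set $U$ consists of a root $r\in U$ and a function $T:U\setminus\{r\}\to U$ such that no non-empty $S\subseteq U\setminus\{r\}$ satisfies $T(S)\subseteq S$. For $j\in U$, $U_j$ is the set of $k$ with $T^m(k)=j$ for some $m\ge0$, and $T_j$ is the restriction of $T$ to $U_j$ (a rooted tree with root $j$). The rooted tree factorial is $T! = \prod_{j\in U}|U_j|$. A rooted subtree $T_0\to T$ is either the empty object (with $\emptyset! = 1$), or the restriction of $T$ to a non-empty $U_0\subseteq U$ with $r\in U_0$ and $T(U_0\setminus\{r\})\subseteq U_0$. The difference forest $T\setminus T_0$ is the collection of trees $T_j$ with $j\in U\setminus U_0$ and $T(j)\in U_0$; when $T_0$ is empty it is $\{T\}$; an empty product equals $1$. -}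

module Defs where

open import Data.Bool using (Bool; true; false; _∧_; _∨_; not; if_then_else_)
open import Data.Nat using (ℕ; zero; suc; _*_)
open import Data.Fin using (Fin)
open import Data.Fin.Properties using (_≟_)
open import Data.Maybe using (Maybe; just; nothing)
open import Data.List using (List; []; _∷_; map; foldr; filter; upTo; allFin; _++_; length; product)
open import Data.Bool.ListAction using (any; all)
open import Data.Vec using (Vec; []; _∷_; lookup; tabulate)
open import Data.Fin.Subset using (Subset; Nonempty; _∈_; _∉_)
open import Relation.Nullary using (¬_)
open import Data.Integer using (+_)
open import Data.Rational using (ℚ; 0ℚ; _/_; _+_)
open import Relation.Nullary.Decidable using (⌊_⌋)

-- A labeled rooted tree on U = Fin n is given by a root r and a parent map
-- T : Fin n → Fin n; the value T r is never used (T is only defined on U ∖ {r}).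

allSubsets : (n : ℕ) → List (Subset n)
allSubsets zero = [] ∷ []
allSubsets (suc n) = map (true ∷_) (allSubsets n) ++ map (false ∷_) (allSubsets n)

_∈ᵇ_ : ∀ {n} → Fin n → Subset n → Bool
k ∈ᵇ S = lookup S k

_==_ : ∀ {n} → Fin n → Fin n → Bool
i == j = ⌊ i ≟ j ⌋

-- iterate the parent map of a tree with root ρ: iter m k = T^m(k), which is
-- undefined (nothing) once the root ρ would have to be passed
iter : ∀ {n} → (Fin n → Fin n) → Fin n → ℕ → Fin n → Maybe (Fin n)
iter T ρ zero k = just k
iter T ρ (suc m) k = if k == ρ then nothing else iter T ρ m (T k)

sameM : ∀ {n} → Maybe (Fin n) → Fin n → Bool
sameM (just i) j = i == j
sameM nothing j = false

-- k ∈ U_j (for the tree with parent map T and root ρ): T^m(k) = j for some m ≥ 0.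
-- The search is over 0 ≤ m ≤ n, which (by pigeonhole) finds every m that exists.
descᵇ : ∀ {n} → (Fin n → Fin n) → Fin n → Fin n → Fin n → Bool
descᵇ {n} T ρ j k = any (λ m → sameM (iter T ρ m k) j) (upTo (suc n))

count : ∀ {n} → (Fin n → Bool) → ℕ
count {n} p = foldr (λ k c → if p k then suc c else c) 0 (allFin n)

prodOver : ∀ {n} → (Fin n → Bool) → (Fin n → ℕ) → ℕ
prodOver {n} p f = foldr (λ k c → if p k then f k * c else c) 1 (allFin n)

-- factorial of the tree with vertex set V, root ρ and parent map T (restricted to V):
-- product over j ∈ V of |V_j|, where V_j = { k ∈ V | T^m(k) = j for some m ≥ 0 }
treeFact : ∀ {n} → (Fin n → Fin n) → Subset n → Fin n → ℕ
treeFact T V ρ = prodOver (λ j → j ∈ᵇ V) (λ j → count (λ k → (k ∈ᵇ V) ∧ descᵇ T ρ j k))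

fullSet : ∀ {n} → Subset n
fullSet = tabulate (λ _ → true)

subtreeSet : ∀ {n} → (Fin n → Fin n) → Fin n → Fin n → Subset n
subtreeSet T r j = tabulate (λ k → descᵇ T r j k)

isEmptyᵇ : ∀ {n} → Subset n → Bool
isEmptyᵇ {n} S = all (λ k → not (k ∈ᵇ S)) (allFin n)

isRootedSubsetᵇ : ∀ {n} → (Fin n → Fin n) → Fin n → Subset n → Bool
isRootedSubsetᵇ {n} T r U₀ =
  (r ∈ᵇ U₀) ∧ all (λ k → not ((k ∈ᵇ U₀) ∧ not (k == r)) ∨ (T k ∈ᵇ U₀)) (allFin n)

-- rooted subtrees T₀ → T, encoded by their vertex sets; the empty subset encodes
-- the empty subtree
isSubtreeᵇ : ∀ {n} → (Fin n → Fin n) → Fin n → Subset n → Bool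
isSubtreeᵇ T r U₀ = isEmptyᵇ U₀ ∨ isRootedSubsetᵇ T r U₀

-- T₀! (with ∅! = 1; the empty product in treeFact gives this automatically)
subtreeFact : ∀ {n} → (Fin n → Fin n) → Fin n → Subset n → ℕ
subtreeFact T r U₀ = if isEmptyᵇ U₀ then 1 else treeFact T U₀ r

-- ∏_{T' ∈ T ∖ T₀} T'!  : the difference forest is {T} if T₀ is empty, and otherwise
-- consists of the T_j with j ∉ U₀, j ≠ r, T(j) ∈ U₀
forestFact : ∀ {n} → (Fin n → Fin n) → Fin n → Subset n → ℕ
forestFact T r U₀ =
  if isEmptyᵇ U₀ then treeFact T fullSet r
  else prodOver (λ j → not (j ∈ᵇ U₀) ∧ not (j == r) ∧ (T j ∈ᵇ U₀))
                (λ j → treeFact T (subtreeSet T r j) j)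

-- exact rational quotient a / d (d is always positive where used; d = 0 gives 0)
frac : ℕ → ℕ → ℚ
frac a zero = 0ℚ
frac a (suc d) = (+ a) / suc d

treeBinom : ∀ {n} → (Fin n → Fin n) → Fin n → Subset n → ℚ
treeBinom T r U₀ = frac (treeFact T fullSet r) (subtreeFact T r U₀ * forestFact T r U₀)

sumBinom : ∀ {n} → (Fin n → Fin n) → Fin n → ℚ
sumBinom {n} T r =
  foldr (λ U₀ acc → if isSubtreeᵇ T r U₀ then treeBinom T r U₀ + acc else acc) 0ℚ (allSubsets n)

-- T together with r is a labeled rooted tree: no non-empty S ⊆ U ∖ {r} has T(S) ⊆ S
IsRootedTree : ∀ {n} → (Fin n → Fin n) → Fin n → Set
IsRootedTree {n} T r = (S : Subset n) → Nonempty S → r ∉ S → ¬ (∀ {k} → k ∈ S → T k ∈ S)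

{-# OPTIONS --safe #-}

-- Write e(W) for the number of linear extensions of a set W of vertices, i.e. orderings of W
-- in which every vertex comes after its ancestors. The hook length formula e(W) · W! = |W|!
-- turns the tree binomial of a rooted subtree T₀ into C(n, |T₀|) · e(T₀) · e(T ∖ T₀) / e(T).
-- Cutting a linear extension of T after its i-th vertex splits it into linear extensions of an
-- ancestor-closed set T₀ with i vertices and of its complement, so these products sum to e(T)
-- over all T₀ of size i, and the tree binomials sum to Σᵢ C(n, i) = 2ⁿ.
module Submission where

open import Algebra.Bundles using (CommutativeMonoid)
import Algebra.Properties.CommutativeMonoid.Sum as MonoidSum
import Algebra.Properties.CommutativeSemigroup as CommutativeSemigroupProperties
import Algebra.Properties.Semiring.Binomial as SemiringBinomial
import Algebra.Properties.Semiring.Sum as SemiringSum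
open import Data.Bool using (Bool; true; false; if_then_else_; _∧_; _∨_; not)
import Data.Bool as Bool
open import Data.Bool.ListAction using (all)
open import Data.Bool.Properties using (T-≡; T-not-≡; T-∧; T-∨)
import Data.Bool.Properties as B
open import Data.Empty using (⊥-elim)
open import Data.Fin using (Fin; zero; suc; toℕ; fromℕ<; inject≤)
open import Data.Fin.Properties
  using (_≟_; any?; all?; pigeonhole; suc-injective; toℕ≤pred[n]; toℕ-fromℕ<; toℕ-inject≤; toℕ<n; toℕ-injective)
open import Data.Fin.Subset using (Subset; ⊥; ∁; _─_; ∣_∣; _∈_; _∉_)
open import Data.Fin.Subset.Properties using (∣⊥∣≡0; ∣⊤∣≡n; ∣p∣≤n; ∣∁p∣≡n∸∣p∣; p─⊥≡p)
open import Data.Integer using (+_)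
import Data.Integer as ℤ
import Data.Integer.Properties as ℤ
import Data.Integer.Tactic.RingSolver as ℤ-Solver
open import Data.List using (List; []; _∷_; map; _++_; upTo; foldr; allFin)
import Data.List as List
import Data.List.Properties as List
open import Data.List.Membership.Propositional using (lose)
open import Data.List.Membership.Propositional.Properties using (∈-upTo⁺)
open import Data.List.Relation.Unary.All.Properties using (all⁺; all⁻; tabulate⁺; tabulate⁻)
open import Data.List.Relation.Unary.Any using (satisfied)
open import Data.List.Relation.Unary.Any.Properties using (any⁺; any⁻)
open import Data.Maybe using (just)
open import Data.Nat
  using (ℕ; zero; suc; pred; _+_; _*_; _∸_; _^_; _≤_; _<_; s≤s; z≤n; _!; NonZero; >-nonZero; ≢-nonZero⁻¹; +-*-rawSemiring)
open import Data.Nat.Combinatorics using (_C_; nCk≡n!/k![n-k]!; k![n∸k]!∣n!)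
open import Data.Nat.DivMod using (m/n*n≡m)
open import Data.Nat.ListAction using () renaming (sum to sumₗ)
open import Data.Nat.ListAction.Properties using (sum-++)
open import Data.Nat.Properties
  using ( +-0-commutativeMonoid; *-1-commutativeMonoid; +-*-semiring
        ; +-identityʳ; +-comm; +-cancelʳ-≡; *-comm; *-identityˡ; *-identityʳ; *-zeroʳ; *-distribˡ-+; ^-zeroˡ
        ; suc-pred; pred-mono-≤; n<1+n; ≤-<-trans; ≤-trans; <⇒≤; m≤n⇒m<n∨m≡n; 1+n≢0
        ; _!≢0; _!*_!≢0; m*n≢0⇒m≢0 )
import Data.Nat.Properties as ℕ
import Data.Nat.Tactic.RingSolver as ℕ-Solver
open import Data.Product using (Σ; _×_; _,_; proj₁; proj₂)
open import Data.Rational using (ℚ; _/_)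
import Data.Rational as ℚ
import Data.Rational.Properties as ℚ
open import Data.Rational.Unnormalised using (mkℚᵘ; *≡*)
import Data.Rational.Unnormalised as ℚᵘ
import Data.Rational.Unnormalised.Properties as ℚᵘ
open import Data.Sum using (_⊎_; inj₁; inj₂)
open import Data.Vec using ([]; _∷_; lookup; replicate; _[_]≔_; tabulate)
open import Data.Vec.Properties
  using ( tabulate∘lookup; tabulate-cong; ∷-injectiveʳ; []≔-lookup; []≔-idempotent; lookup∘update; lookup∘update′
        ; lookup∘tabulate; lookup⇒[]=; []=⇒lookup; lookup-replicate; lookup-map )
open import Function using (_∘_; id; case_of_)
open import Function.Bundles using (Equivalence; _⇔_; mk⇔)
open import Relation.Binary.PropositionalEquality
  using (_≡_; _≢_; refl; sym; trans; cong; cong₂; subst; module ≡-Reasoning)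
open import Relation.Nullary using (¬_; Dec; yes; no; does)
open import Relation.Nullary.Decidable
  using (dec-true; dec-false; does-⇔; decidable-stable; toWitness; fromWitness; isYes; map′; _×-dec_; _→-dec_)
open import Relation.Unary using (Decidable)
open import Algebra.Definitions.RawSemiring +-*-rawSemiring using () renaming (_^_ to _^ₛ_; _×_ to _×ₛ_)

open import Defs
  using ( IsRootedTree; iter; sameM; descᵇ; _==_; _∈ᵇ_; count; prodOver; treeFact; fullSet; subtreeSet
        ; isEmptyᵇ; isRootedSubsetᵇ; isSubtreeᵇ; subtreeFact; forestFact; frac; treeBinom; allSubsets; sumBinom )

private variable n : ℕ

open MonoidSum +-0-commutativeMonoid using (sum; sum-cong-≗; ∑-comm; ∑-distrib-+)
open SemiringSum +-*-semiring using (*-distribˡ-sum; *-distribʳ-sum)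
open MonoidSum *-1-commutativeMonoid using ()
  renaming (sum to product; sum-cong-≗ to product-cong-≗; ∑-comm to ∏-comm)

module SumProperties {c ℓ} (M : CommutativeMonoid c ℓ) where
  open CommutativeMonoid M
    using (Carrier; _≈_; _∙_; ε; ∙-congˡ; ∙-congʳ; identityˡ; identityʳ; setoid; commutativeSemigroup)
    renaming (refl to ≈-refl; trans to ≈-trans)
  open MonoidSum M using (sum-cong-≋; sum-replicate-zero) renaming (sum to ∑)
  open CommutativeSemigroupProperties commutativeSemigroup using (x∙yz≈y∙xz)
  open import Relation.Binary.Reasoning.Setoid setoid

  ∑-extract : ∀ {n} (i : Fin n) {f g : Fin n → Carrier} →
              (∀ k → k ≢ i → f k ≈ g k) → g i ≈ ε → ∑ f ≈ f i ∙ ∑ g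
  ∑-extract zero {f} {g} f≈g gᵢ≈ε = ∙-congˡ (begin
    ∑ (f ∘ suc)          ≈⟨ sum-cong-≋ (λ k → f≈g (suc k) λ ()) ⟩
    ∑ (g ∘ suc)          ≈⟨ identityˡ _ ⟨
    ε ∙ ∑ (g ∘ suc)      ≈⟨ ∙-congʳ gᵢ≈ε ⟨
    g zero ∙ ∑ (g ∘ suc) ∎)
  ∑-extract (suc i) {f} {g} f≈g gᵢ≈ε = begin
    f zero ∙ ∑ (f ∘ suc)               ≈⟨ ∙-congˡ (∑-extract i (λ k k≢i → f≈g (suc k) (k≢i ∘ suc-injective)) gᵢ≈ε) ⟩
    f zero ∙ (f (suc i) ∙ ∑ (g ∘ suc)) ≈⟨ x∙yz≈y∙xz _ _ _ ⟩
    f (suc i) ∙ (f zero ∙ ∑ (g ∘ suc)) ≈⟨ ∙-congˡ (∙-congʳ (f≈g zero λ ())) ⟩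
    f (suc i) ∙ ∑ g                    ∎

  ∑-single : ∀ {n} (i : Fin n) (f : Fin n → Carrier) → (∀ k → k ≢ i → f k ≈ ε) → ∑ f ≈ f i
  ∑-single {n} i f f≈ε = begin
    ∑ f                      ≈⟨ ∑-extract i {g = λ _ → ε} f≈ε ≈-refl ⟩
    f i ∙ ∑ {n} (λ _ → ε)    ≈⟨ ∙-congˡ (sum-replicate-zero n) ⟩
    f i ∙ ε                  ≈⟨ identityʳ _ ⟩
    f i                      ∎

  ∑-zero : ∀ {n} (f : Fin n → Carrier) → (∀ k → f k ≈ ε) → ∑ f ≈ ε
  ∑-zero {n} f f≈ε = ≈-trans (sum-cong-≋ f≈ε) (sum-replicate-zero n)

open SumProperties +-0-commutativeMonoid using ()
  renaming (∑-single to sum-single; ∑-zero to sum-zero)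
open SumProperties *-1-commutativeMonoid using ()
  renaming (∑-extract to product-extract; ∑-zero to product-one)

∑ₛ : ∀ {n} → (Subset n → ℕ) → ℕ
∑ₛ {zero}  f = f []
∑ₛ {suc n} f = ∑ₛ (f ∘ (true ∷_)) + ∑ₛ (f ∘ (false ∷_))

∑ₛ-cong : {f g : Subset n → ℕ} → (∀ S → f S ≡ g S) → ∑ₛ f ≡ ∑ₛ g
∑ₛ-cong {zero}  f≗g = f≗g []
∑ₛ-cong {suc n} f≗g = cong₂ _+_ (∑ₛ-cong (f≗g ∘ (true ∷_))) (∑ₛ-cong (f≗g ∘ (false ∷_)))

∑ₛ-zero : (f : Subset n → ℕ) → (∀ S → f S ≡ 0) → ∑ₛ f ≡ 0
∑ₛ-zero {zero}  f f≡0 = f≡0 []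
∑ₛ-zero {suc n} f f≡0 = cong₂ _+_ (∑ₛ-zero _ (f≡0 ∘ (true ∷_))) (∑ₛ-zero _ (f≡0 ∘ (false ∷_)))

*-distribˡ-∑ₛ : ∀ c (f : Subset n → ℕ) → c * ∑ₛ f ≡ ∑ₛ (λ S → c * f S)
*-distribˡ-∑ₛ {zero}  c f = refl
*-distribˡ-∑ₛ {suc n} c f = trans (*-distribˡ-+ c (∑ₛ (f ∘ (true ∷_))) (∑ₛ (f ∘ (false ∷_))))
  (cong₂ _+_ (*-distribˡ-∑ₛ c (f ∘ (true ∷_))) (*-distribˡ-∑ₛ c (f ∘ (false ∷_))))

∑ₛ-if : ∀ b {f : Subset n → ℕ} → ∑ₛ (λ S → if b then f S else 0) ≡ (if b then ∑ₛ f else 0)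
∑ₛ-if {n} true  = refl
∑ₛ-if {n} false = ∑ₛ-zero {n} _ (λ _ → refl)

∑ₛ-comm : ∀ {m} (f : Subset n → Fin m → ℕ) → ∑ₛ (λ S → sum (f S)) ≡ sum (λ k → ∑ₛ (λ S → f S k))
∑ₛ-comm {zero}  f = refl
∑ₛ-comm {suc n} f = trans (cong₂ _+_ (∑ₛ-comm (f ∘ (true ∷_))) (∑ₛ-comm (f ∘ (false ∷_))))
  (sym (∑-distrib-+ (λ k → ∑ₛ (λ S → f (true ∷ S) k)) (λ k → ∑ₛ (λ S → f (false ∷ S) k))))

∑ₛ-only-⊥ : (f : Subset n → ℕ) → (∀ S → S ≢ ⊥ → f S ≡ 0) → ∑ₛ f ≡ f ⊥
∑ₛ-only-⊥ {zero}  f f≡0 = refl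
∑ₛ-only-⊥ {suc n} f f≡0 = cong₂ _+_ (∑ₛ-zero {n} _ (λ S → f≡0 (true ∷ S) λ ()))
  (∑ₛ-only-⊥ (f ∘ (false ∷_)) (λ S S≢⊥ → f≡0 (false ∷ S) (S≢⊥ ∘ ∷-injectiveʳ)))

∑ₛ-insert : (m : Fin n) (f : Subset n → ℕ) →
  ∑ₛ (λ S → if lookup S m then f S else 0) ≡ ∑ₛ (λ J → if lookup J m then 0 else f (J [ m ]≔ true))
∑ₛ-insert {suc n} zero    f = begin
  ∑ₛ (f ∘ (true ∷_)) + ∑ₛ {n} (λ _ → 0) ≡⟨ +-comm (∑ₛ (f ∘ (true ∷_))) _ ⟩
  ∑ₛ {n} (λ _ → 0) + ∑ₛ (f ∘ (true ∷_)) ∎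
  where open ≡-Reasoning
∑ₛ-insert {suc n} (suc m) f =
  cong₂ _+_ (∑ₛ-insert m (f ∘ (true ∷_))) (∑ₛ-insert m (f ∘ (false ∷_)))

∑ₛ-allSubsets : (f : Subset n → ℕ) → sumₗ (map f (allSubsets n)) ≡ ∑ₛ f
∑ₛ-allSubsets {zero}  f = +-identityʳ (f [])
∑ₛ-allSubsets {suc n} f = begin
  sumₗ (map f (map (true ∷_) subsets ++ map (false ∷_) subsets))
    ≡⟨ cong sumₗ (List.map-++ f (map (true ∷_) subsets) _) ⟩
  sumₗ (map f (map (true ∷_) subsets) ++ map f (map (false ∷_) subsets))
    ≡⟨ sum-++ (map f (map (true ∷_) subsets)) _ ⟩
  sumₗ (map f (map (true ∷_) subsets)) + sumₗ (map f (map (false ∷_) subsets))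
    ≡⟨ cong₂ _+_ (cong sumₗ (sym (List.map-∘ subsets))) (cong sumₗ (sym (List.map-∘ subsets))) ⟩
  sumₗ (map (f ∘ (true ∷_)) subsets) + sumₗ (map (f ∘ (false ∷_)) subsets)
    ≡⟨ cong₂ _+_ (∑ₛ-allSubsets (f ∘ (true ∷_))) (∑ₛ-allSubsets (f ∘ (false ∷_))) ⟩
  ∑ₛ f ∎
  where
  open ≡-Reasoning
  subsets = allSubsets n

true≢false : true ≢ false
true≢false ()

∧-≡-true : ∀ {x y} → x ∧ y ≡ true ⇔ (x ≡ true × y ≡ true)
∧-≡-true {true}  = mk⇔ (refl ,_) proj₂
∧-≡-true {false} = mk⇔ (λ ()) (λ ())

indicator : Bool → ℕ
indicator b = if b then 1 else 0

∣p∣≡∑indicator : (p : Subset n) → ∣ p ∣ ≡ sum (indicator ∘ lookup p)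
∣p∣≡∑indicator []          = refl
∣p∣≡∑indicator (true ∷ p)  = cong suc (∣p∣≡∑indicator p)
∣p∣≡∑indicator (false ∷ p) = ∣p∣≡∑indicator p

∣p∣≡0⇒p≡⊥ : (p : Subset n) → ∣ p ∣ ≡ 0 → p ≡ ⊥
∣p∣≡0⇒p≡⊥ []          _     = refl
∣p∣≡0⇒p≡⊥ (false ∷ p) ∣p∣≡0 = cong (false ∷_) (∣p∣≡0⇒p≡⊥ p ∣p∣≡0)

∣p[i]≔true∣≡1+∣p[i]≔false∣ : (p : Subset n) (i : Fin n) → ∣ p [ i ]≔ true ∣ ≡ suc ∣ p [ i ]≔ false ∣
∣p[i]≔true∣≡1+∣p[i]≔false∣ (_ ∷ p)     zero    = refl
∣p[i]≔true∣≡1+∣p[i]≔false∣ (true ∷ p)  (suc i) = cong suc (∣p[i]≔true∣≡1+∣p[i]≔false∣ p i)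
∣p[i]≔true∣≡1+∣p[i]≔false∣ (false ∷ p) (suc i) = ∣p[i]≔true∣≡1+∣p[i]≔false∣ p i

[]≔-same : (p : Subset n) {i : Fin n} {b : Bool} → lookup p i ≡ b → p [ i ]≔ b ≡ p
[]≔-same p {i} refl = []≔-lookup p i

∣p∣≡1+∣p[i]≔false∣ : (p : Subset n) {i : Fin n} → lookup p i ≡ true → ∣ p ∣ ≡ suc ∣ p [ i ]≔ false ∣
∣p∣≡1+∣p[i]≔false∣ p {i} pᵢ = trans (cong ∣_∣ (sym ([]≔-same p pᵢ))) (∣p[i]≔true∣≡1+∣p[i]≔false∣ p i)

∣p[i]≔true∣≡1+∣p∣ : (p : Subset n) {i : Fin n} → lookup p i ≡ false → ∣ p [ i ]≔ true ∣ ≡ suc ∣ p ∣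
∣p[i]≔true∣≡1+∣p∣ p {i} pᵢ = trans (∣p[i]≔true∣≡1+∣p[i]≔false∣ p i) (cong (suc ∘ ∣_∣) ([]≔-same p pᵢ))

lookup-─-inside : (p q : Subset n) {i : Fin n} → lookup q i ≡ true → lookup (p ─ q) i ≡ false
lookup-─-inside (_ ∷ _) (_ ∷ _) {zero}  refl = refl
lookup-─-inside (_ ∷ p) (_ ∷ q) {suc i} qᵢ   = lookup-─-inside p q qᵢ

lookup-─-outside : (p q : Subset n) {i : Fin n} → lookup q i ≡ false → lookup (p ─ q) i ≡ lookup p i
lookup-─-outside (_ ∷ _) (_ ∷ _) {zero}  refl = refl
lookup-─-outside (_ ∷ p) (_ ∷ q) {suc i} qᵢ   = lookup-─-outside p q qᵢ

lookup-injective : {p q : Subset n} → (∀ i → lookup p i ≡ lookup q i) → p ≡ q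
lookup-injective {p = p} {q} p≗q = trans (sym (tabulate∘lookup p)) (trans (tabulate-cong p≗q) (tabulate∘lookup q))

subset : {P : Fin n → Set} → Decidable P → Subset n
subset P? = tabulate (isYes ∘ P?)

∈-subset⁺ : {P : Fin n → Set} {P? : Decidable P} {x : Fin n} → P x → x ∈ subset P?
∈-subset⁺ {P? = P?} {x} px = lookup⇒[]= x _ (trans (lookup∘tabulate _ x) (Equivalence.to T-≡ (fromWitness px)))

∈-subset⁻ : {P : Fin n → Set} {P? : Decidable P} {x : Fin n} → x ∈ subset P? → P x
∈-subset⁻ {P? = P?} {x} x∈ = toWitness (Equivalence.from T-≡ (trans (sym (lookup∘tabulate _ x)) ([]=⇒lookup x∈)))

count-tabulate : ∀ {m} (p : Fin n → Bool) (g : Fin m → Fin n) →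
  foldr (λ k c → if p k then suc c else c) 0 (List.tabulate g) ≡ sum (indicator ∘ p ∘ g)
count-tabulate {m = zero}  p g = refl
count-tabulate {m = suc m} p g with p (g zero)
... | true  = cong suc (count-tabulate p (g ∘ suc))
... | false = count-tabulate p (g ∘ suc)

count≡∑ : (p : Fin n → Bool) → count p ≡ sum (indicator ∘ p)
count≡∑ p = count-tabulate p id

count-cong : {p q : Fin n → Bool} → (∀ k → p k ≡ q k) → count p ≡ count q
count-cong {p = p} {q} p≗q = trans (count≡∑ p) (trans (sum-cong-≗ (cong indicator ∘ p≗q)) (sym (count≡∑ q)))

prodOver-tabulate : ∀ {m} (p : Fin n → Bool) (f : Fin n → ℕ) (g : Fin m → Fin n) →
  foldr (λ k c → if p k then f k * c else c) 1 (List.tabulate g) ≡ product (λ k → if p (g k) then f (g k) else 1)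
prodOver-tabulate {m = zero}  p f g = refl
prodOver-tabulate {m = suc m} p f g with p (g zero)
... | true  = cong (f (g zero) *_) (prodOver-tabulate p f (g ∘ suc))
... | false = trans (prodOver-tabulate p f (g ∘ suc)) (sym (+-identityʳ _))

prodOver≡∏ : (p : Fin n → Bool) (f : Fin n → ℕ) → prodOver p f ≡ product (λ k → if p k then f k else 1)
prodOver≡∏ p f = prodOver-tabulate p f id

==⇒≡ : {i j : Fin n} → (i == j) ≡ true → i ≡ j
==⇒≡ = toWitness ∘ Equivalence.from T-≡

≡⇒== : {i j : Fin n} → i ≡ j → (i == j) ≡ true
≡⇒== = Equivalence.to T-≡ ∘ fromWitness

all-allFin : (p : Fin n → Bool) → Bool.T (all p (allFin n)) ⇔ (∀ k → Bool.T (p k))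
all-allFin {n} p = mk⇔ (λ h → tabulate⁻ (all⁺ p (allFin n) h)) (λ h → all⁻ p (tabulate⁺ h))

⇔-does : ∀ {a} {A : Set a} {b : Bool} → (Bool.T b ⇔ A) → (a? : Dec A) → b ≡ does a?
⇔-does {b = true}  b⇔A a? = sym (dec-true a? (Equivalence.to b⇔A _))
⇔-does {b = false} b⇔A a? = sym (dec-false a? (Equivalence.from b⇔A))

C*k!*[n∸k]!≡n! : ∀ {n k} → k ≤ n → (n C k) * (k ! * (n ∸ k) !) ≡ n !
C*k!*[n∸k]!≡n! {n} {k} k≤n = trans (cong (_* (k ! * (n ∸ k) !)) (nCk≡n!/k![n-k]! k≤n)) (m/n*n≡m (k![n∸k]!∣n! k≤n))
  where instance _ = k !* (n ∸ k) !≢0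

∑-binomial≡2^ : ∀ n → sum {suc n} (λ k → n C toℕ k) ≡ 2 ^ n
∑-binomial≡2^ n = begin
  sum {suc n} (λ k → n C toℕ k)                           ≡⟨ sum-cong-≗ {suc n} binomialTerm≡C ⟨
  sum (SemiringBinomial.binomialTerm +-*-semiring 1 1 n)  ≡⟨ SemiringBinomial.theorem +-*-semiring 1 1 refl n ⟨
  2 ^ₛ n                                                  ≡⟨ ^ₛ≡^ 2 n ⟩
  2 ^ n                                                   ∎
  where
  open ≡-Reasoning
  ^ₛ≡^ : ∀ a m → a ^ₛ m ≡ a ^ m
  ^ₛ≡^ a zero    = refl
  ^ₛ≡^ a (suc m) = cong (a *_) (^ₛ≡^ a m)
  ×ₛ1≡ : ∀ m → m ×ₛ 1 ≡ m
  ×ₛ1≡ zero    = refl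
  ×ₛ1≡ (suc m) = cong suc (×ₛ1≡ m)
  binomialTerm≡C : ∀ k → (n C toℕ k) ×ₛ (1 ^ₛ toℕ k * 1 ^ₛ (n ∸ toℕ k)) ≡ n C toℕ k
  binomialTerm≡C k rewrite ^ₛ≡^ 1 (toℕ k) | ^ₛ≡^ 1 (n ∸ toℕ k) | ^-zeroˡ (toℕ k) | ^-zeroˡ (n ∸ toℕ k) = ×ₛ1≡ (n C toℕ k)

-- Opaque, so that goals containing these fractions are not normalised into gcd computations.
opaque
  _/1+_ : ℕ → ℕ → ℚ
  c /1+ d = (+ c) / suc d

  /1+-+ : ∀ d a b → a /1+ d ℚ.+ b /1+ d ≡ (a + b) /1+ d
  /1+-+ d a b = ℚ.toℚᵘ-injective (begin
    ℚ.toℚᵘ (a /1+ d ℚ.+ b /1+ d)                   ≈⟨ ℚ.toℚᵘ-homo-+ (a /1+ d) (b /1+ d) ⟩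
    ℚ.toℚᵘ (a /1+ d) ℚᵘ.+ ℚ.toℚᵘ (b /1+ d)          ≈⟨ ℚᵘ.+-cong (ℚ.toℚᵘ-fromℚᵘ (mkℚᵘ (+ a) d)) (ℚ.toℚᵘ-fromℚᵘ (mkℚᵘ (+ b) d)) ⟩
    mkℚᵘ (+ a) d ℚᵘ.+ mkℚᵘ (+ b) d                  ≈⟨ *≡* same-denominator ⟩
    mkℚᵘ (+ (a + b)) d                              ≈⟨ ℚ.toℚᵘ-fromℚᵘ (mkℚᵘ (+ (a + b)) d) ⟨
    ℚ.toℚᵘ ((a + b) /1+ d)                          ∎)
    where
    open ℚᵘ.≃-Reasoning
    distrib : ∀ (x y z : ℤ.ℤ) → (x ℤ.* z ℤ.+ y ℤ.* z) ℤ.* z ≡ (x ℤ.+ y) ℤ.* (z ℤ.* z)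
    distrib = ℤ-Solver.solve-∀
    same-denominator : (+ a ℤ.* + suc d ℤ.+ + b ℤ.* + suc d) ℤ.* + suc d ≡ + (a + b) ℤ.* (+ suc d ℤ.* + suc d)
    same-denominator = trans (distrib (+ a) (+ b) (+ suc d)) (cong₂ ℤ._*_ (sym (ℤ.pos-+ a b)) (sym (ℤ.pos-* (suc d) (suc d))))

  frac≡/1+ : ∀ {a x c} d → x ≢ 0 → a * suc d ≡ c * x → frac a x ≡ c /1+ d
  frac≡/1+ {x = zero}  d x≢0 _  = ⊥-elim (x≢0 refl)
  frac≡/1+ {a} {suc x} {c} d _ eq = ℚ.fromℚᵘ-cong {mkℚᵘ (+ a) x} {mkℚᵘ (+ c) d} (*≡* (trans (sym (ℤ.pos-* a (suc d))) (trans (cong +_ eq) (ℤ.pos-* c (suc x)))))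

  *1+/1+≡ : ∀ d a → (a * suc d) /1+ d ≡ (+ a) / 1
  *1+/1+≡ d a = ℚ.fromℚᵘ-cong {mkℚᵘ (+ (a * suc d)) d} {mkℚᵘ (+ a) 0}
    (*≡* (trans (sym (ℤ.pos-* (a * suc d) 1)) (trans (cong +_ (*-identityʳ (a * suc d))) (ℤ.pos-* a (suc d)))))

  0/1+≡0 : ∀ d → 0 /1+ d ≡ ℚ.0ℚ
  0/1+≡0 d = ℚ.0/n≡0 (suc d)

iterate : ∀ {a} {A : Set a} → (A → A) → ℕ → A → A
iterate f zero    x = x
iterate f (suc m) x = iterate f m (f x)

iterate-suc : ∀ {a} {A : Set a} (f : A → A) m x → iterate f (suc m) x ≡ f (iterate f m x)
iterate-suc f zero    x = refl
iterate-suc f (suc m) x = iterate-suc f m (f x)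

module RootedTree {n : ℕ} (T : Fin n → Fin n) (r : Fin n) where

  data Walk (ρ j : Fin n) : Fin n → Set where
    stop : Walk ρ j j
    step : ∀ {k} → k ≢ ρ → Walk ρ j (T k) → Walk ρ j k

  length : ∀ {ρ j k} → Walk ρ j k → ℕ
  length stop       = 0
  length (step _ w) = suc (length w)

  walk-trans : ∀ {ρ i j k} → Walk ρ i j → Walk ρ j k → Walk ρ i k
  walk-trans v stop         = v
  walk-trans v (step k≢ρ w) = step k≢ρ (walk-trans v w)

  length-walk-trans : ∀ {ρ i j k} (v : Walk ρ i j) (w : Walk ρ j k) →
                      length (walk-trans v w) ≡ length w + length v
  length-walk-trans v stop       = refl
  length-walk-trans v (step _ w) = cong suc (length-walk-trans v w)

  walk-comparable : ∀ {ρ j j' k} → Walk ρ j k → Walk ρ j' k → Walk ρ j' j ⊎ Walk ρ j j'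
  walk-comparable stop           w'            = inj₁ w'
  walk-comparable (step k≢ρ w)   stop          = inj₂ (step k≢ρ w)
  walk-comparable (step _ w)     (step _ w')   = walk-comparable w w'

  walk-length-unique : ∀ {ρ k} (w w' : Walk ρ ρ k) → length w ≡ length w'
  walk-length-unique stop         stop          = refl
  walk-length-unique stop         (step ρ≢ρ _)  = ⊥-elim (ρ≢ρ refl)
  walk-length-unique (step ρ≢ρ _) stop          = ⊥-elim (ρ≢ρ refl)
  walk-length-unique (step _ w)   (step _ w')   = cong suc (walk-length-unique w w')

  walk⇒iter : ∀ {ρ j k} (w : Walk ρ j k) → iter T ρ (length w) k ≡ just j
  walk⇒iter stop = refl
  walk⇒iter {ρ} (step {k} k≢ρ w) with k ≟ ρ
  ... | yes k≡ρ = ⊥-elim (k≢ρ k≡ρ)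
  ... | no _    = walk⇒iter w

  iter⇒walk : ∀ {ρ j} m k → iter T ρ m k ≡ just j → Walk ρ j k
  iter⇒walk zero    k refl = stop
  iter⇒walk {ρ} (suc m) k hit with k ≟ ρ | hit
  ... | no k≢ρ | hit′ = step k≢ρ (iter⇒walk m (T k) hit′)

  descᵇ⇒walk : ∀ {ρ j k} → descᵇ T ρ j k ≡ true → Walk ρ j k
  descᵇ⇒walk {ρ} {j} {k} d
    with m , hitₘ ← satisfied (any⁻ (λ m → sameM (iter T ρ m k) j) (upTo (suc n)) (Equivalence.from T-≡ d))
    = iter⇒walk m k (sameM⇒just (iter T ρ m k) (Equivalence.to T-≡ hitₘ))
    where
    sameM⇒just : ∀ x → sameM x j ≡ true → x ≡ just j
    sameM⇒just (just i) i==j = cong just (==⇒≡ i==j)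

  walk⇒descᵇ : ∀ {ρ j k} (w : Walk ρ j k) → length w ≤ n → descᵇ T ρ j k ≡ true
  walk⇒descᵇ {ρ} {j} {k} w w≤n =
    Equivalence.to T-≡ (any⁺ (λ m → sameM (iter T ρ m k) j) (lose (∈-upTo⁺ (s≤s w≤n)) (Equivalence.from T-≡ hit)))
    where
    hit : sameM (iter T ρ (length w) k) j ≡ true
    hit rewrite walk⇒iter w = ≡⇒== refl

  infix 4 _≼_
  _≼_ : Fin n → Fin n → Set
  j ≼ k = Walk r j k

  parent≼ : ∀ {k} → k ≢ r → T k ≼ k
  parent≼ k≢r = step k≢r stop

  ≼-root : ∀ {j} → j ≼ r → j ≡ r
  ≼-root stop         = refl
  ≼-root (step r≢r _) = ⊥-elim (r≢r refl)

  ≼-unstep : ∀ {j k} → k ≢ r → j ≼ k → j ≡ k ⊎ j ≼ T k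
  ≼-unstep _ stop       = inj₁ refl
  ≼-unstep _ (step _ w) = inj₂ w

  ≼-parent : ∀ {ρ k} → ρ ≼ k → k ≢ ρ → ρ ≼ T k
  ≼-parent stop       k≢k = ⊥-elim (k≢k refl)
  ≼-parent (step _ w) _   = w

  module _ (tree : IsRootedTree T r) where

    -- Otherwise the iterates T⁰ k, …, Tᵇ⁻¹ k before the first repetition Tᵇ k = Tⁱ k
    -- form a nonempty T-closed set avoiding r.
    iterates-hit-r : ∀ k → ¬ ¬ (Σ (Fin (suc n)) λ a → iterate T (toℕ a) k ≡ r)
    iterates-hit-r k misses = tree orbit (k , k∈orbit) r∉orbit orbit-closed
      where
      collision = pigeonhole (n<1+n n) (λ (a : Fin (suc n)) → iterate T (toℕ a) k)
      i = proj₁ collision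
      b = toℕ (proj₁ (proj₂ collision))
      i<b : toℕ i < b
      i<b = proj₁ (proj₂ (proj₂ collision))
      Tⁱ≡Tᵇ : iterate T (toℕ i) k ≡ iterate T b k
      Tⁱ≡Tᵇ = proj₂ (proj₂ (proj₂ collision))

      Orbit : Fin n → Set
      Orbit x = Σ (Fin b) λ c → iterate T (toℕ c) k ≡ x

      orbit : Subset n
      orbit = subset {P = Orbit} (λ x → any? (λ c → iterate T (toℕ c) k ≟ x))

      ∈-orbit⁻ : ∀ {x} → x ∈ orbit → Orbit x
      ∈-orbit⁻ = ∈-subset⁻ {P = Orbit}

      orbit-index : ∀ {c} → c < b → ∀ {x} → iterate T c k ≡ x → x ∈ orbit
      orbit-index c<b {x} hit = ∈-subset⁺ (fromℕ< c<b , trans (cong (λ c → iterate T c k) (toℕ-fromℕ< c<b)) hit)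

      k∈orbit : k ∈ orbit
      k∈orbit = orbit-index (≤-<-trans z≤n i<b) refl

      r∉orbit : r ∉ orbit
      r∉orbit r∈orbit with c , hit ← ∈-orbit⁻ r∈orbit =
        misses (inject≤ c b≤1+n , trans (cong (λ c → iterate T c k) (toℕ-inject≤ c b≤1+n)) hit)
        where b≤1+n = <⇒≤ (toℕ<n (proj₁ (proj₂ collision)))

      orbit-closed : ∀ {x} → x ∈ orbit → T x ∈ orbit
      orbit-closed x∈orbit with c , refl ← ∈-orbit⁻ x∈orbit with m≤n⇒m<n∨m≡n (toℕ<n c)
      ... | inj₁ 1+c<b = orbit-index 1+c<b (iterate-suc T (toℕ c) k)
      ... | inj₂ 1+c≡b = orbit-index i<b (trans Tⁱ≡Tᵇ (trans (cong (λ c → iterate T c k) (sym 1+c≡b)) (iterate-suc T (toℕ c) k)))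

    hits-root : ∀ k → Σ ℕ λ a → a ≤ n × iterate T a k ≡ r
    hits-root k with a , hit ← decidable-stable (any? λ a → iterate T (toℕ a) k ≟ r) (iterates-hit-r k) =
      toℕ a , toℕ≤pred[n] a , hit

    iterate⇒walk : ∀ a k → iterate T a k ≡ r → Σ (r ≼ k) λ w → length w ≤ a
    iterate⇒walk zero    k refl = stop , z≤n
    iterate⇒walk (suc a) k hit with k ≟ r
    ... | yes refl = stop , z≤n
    ... | no  k≢r  with w , w≤a ← iterate⇒walk a (T k) hit = step k≢r w , s≤s w≤a

    root-walk : ∀ k → Σ (r ≼ k) λ w → length w ≤ n
    root-walk k with a , a≤n , hit ← hits-root k with w , w≤a ← iterate⇒walk a k hit = w , ≤-trans w≤a a≤n

    r≼ : ∀ k → r ≼ k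
    r≼ k = proj₁ (root-walk k)

    walk-shorter : ∀ {ρ j k} → ρ ≼ k → (v : r ≼ k) (w : Walk ρ j k) → length w ≤ length v
    walk-shorter _   _          stop          = z≤n
    walk-shorter ρ≼r stop       (step r≢ρ _)  = ⊥-elim (r≢ρ (sym (≼-root ρ≼r)))
    walk-shorter ρ≼k (step _ v) (step k≢ρ w)  = s≤s (walk-shorter (≼-parent ρ≼k k≢ρ) v w)

    walk-length≤n : ∀ {ρ j k} → ρ ≼ k → (w : Walk ρ j k) → length w ≤ n
    walk-length≤n {k = k} ρ≼k w = ≤-trans (walk-shorter ρ≼k (r≼ k) w) (proj₂ (root-walk k))

    ¬≼parent : ∀ {k} → k ≢ r → ¬ k ≼ T k
    ¬≼parent {k} k≢r w = 1+n≢0 (+-cancelʳ-≡ (length u) (length loop) 0 loop-vanishes)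
      where
      u = r≼ k
      loop = walk-trans w (parent≼ k≢r)
      loop-vanishes : length loop + length u ≡ length u
      loop-vanishes = trans (sym (length-walk-trans u loop)) (walk-length-unique (walk-trans u loop) u)

    parent≢ : ∀ {k} → k ≢ r → T k ≢ k
    parent≢ {k} k≢r Tk≡k = ¬≼parent k≢r (subst (k ≼_) (sym Tk≡k) stop)

    ≼⇒descᵇ : ∀ {j k} → j ≼ k → descᵇ T r j k ≡ true
    ≼⇒descᵇ {k = k} w = walk⇒descᵇ w (walk-length≤n (r≼ k) w)

    _≼?_ : (j k : Fin n) → Dec (j ≼ k)
    j ≼? k = map′ descᵇ⇒walk ≼⇒descᵇ (descᵇ T r j k B.≟ true)

    walk⇒≼ : ∀ {ρ j k} → ρ ≼ k → Walk ρ j k → j ≼ k × ρ ≼ j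
    walk⇒≼ ρ≼k stop = stop , ρ≼k
    walk⇒≼ {ρ} {k = k} ρ≼k (step k≢ρ w) with j≼Tk , ρ≼j ← walk⇒≼ (≼-parent ρ≼k k≢ρ) w =
      step k≢r j≼Tk , ρ≼j
      where
      k≢r : k ≢ r
      k≢r refl = k≢ρ (sym (≼-root ρ≼k))

    ≼⇒walk : ∀ {ρ j k} → j ≼ k → ρ ≼ j → Walk ρ j k
    ≼⇒walk stop _ = stop
    ≼⇒walk (step k≢r j≼Tk) ρ≼j = step k≢ρ (≼⇒walk j≼Tk ρ≼j)
      where
      k≢ρ : _ ≢ _
      k≢ρ refl = ¬≼parent k≢r (walk-trans ρ≼j j≼Tk)

    descᵇ-within⇒≼ : ∀ {ρ j k} → ρ ≼ k → descᵇ T ρ j k ≡ true → j ≼ k × ρ ≼ j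
    descᵇ-within⇒≼ ρ≼k = walk⇒≼ ρ≼k ∘ descᵇ⇒walk

    ≼⇒descᵇ-within : ∀ {ρ j k} → j ≼ k → ρ ≼ j → descᵇ T ρ j k ≡ true
    ≼⇒descᵇ-within j≼k ρ≼j = walk⇒descᵇ w (walk-length≤n (walk-trans ρ≼j j≼k) w)
      where w = ≼⇒walk j≼k ρ≼j

    Root : Subset n → Fin n → Set
    Root W m = lookup W m ≡ true × (∀ j → lookup W j ≡ true → j ≼ m → j ≡ m)

    opaque
      Root? : (W : Subset n) (m : Fin n) → Dec (Root W m)
      Root? W m = (lookup W m B.≟ true) ×-dec all? (λ j → (lookup W j B.≟ true) →-dec ((j ≼? m) →-dec (j ≟ m)))

    root-unique : ∀ {W m m' k} → Root W m → Root W m' → m ≼ k → m' ≼ k → m ≡ m'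
    root-unique (m∈W , m-min) (m'∈W , m'-min) m≼k m'≼k with walk-comparable m≼k m'≼k
    ... | inj₁ m'≼m = sym (m-min _ m'∈W m'≼m)
    ... | inj₂ m≼m' = m'-min _ m∈W m≼m'

    -- Walking down from the root to k, the first vertex of W met is a root of W.
    first-in : ∀ W {k} → r ≼ k → (Σ (Fin n) λ m → Root W m × m ≼ k) ⊎ (∀ j → j ≼ k → lookup W j ≡ false)
    first-in W stop with lookup W r in r∈W
    ... | true  = inj₁ (r , (r∈W , λ _ _ → ≼-root) , stop)
    ... | false = inj₂ (λ j j≼r → subst (λ j → lookup W j ≡ false) (sym (≼-root j≼r)) r∈W)
    first-in W {k} (step k≢r w) with first-in W w
    ... | inj₁ (m , root , m≼Tk) = inj₁ (m , root , walk-trans m≼Tk (parent≼ k≢r))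
    ... | inj₂ above with lookup W k in k∈W
    ...   | true  = inj₁ (k , (k∈W , k-min) , stop)
      where
      k-min : ∀ j → lookup W j ≡ true → j ≼ k → j ≡ k
      k-min j j∈W j≼k with ≼-unstep k≢r j≼k
      ... | inj₁ j≡k  = j≡k
      ... | inj₂ j≼Tk = ⊥-elim (true≢false (trans (sym j∈W) (above j j≼Tk)))
    ...   | false = inj₂ λ j j≼k → case ≼-unstep k≢r j≼k of λ
      { (inj₁ refl) → k∈W
      ; (inj₂ j≼Tk) → above j j≼Tk }

    root-below : ∀ W {k} → lookup W k ≡ true → Σ (Fin n) λ m → Root W m × m ≼ k
    root-below W {k} k∈W with first-in W (r≼ k)
    ... | inj₁ found = found
    ... | inj₂ none  = ⊥-elim (true≢false (trans (sym k∈W) (none k stop)))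

    module RootsAbove {c ℓ} (M : CommutativeMonoid c ℓ) where
      open CommutativeMonoid M using (Carrier; _≈_; ε; reflexive) renaming (refl to ≈-refl; trans to ≈-trans)
      open MonoidSum M using () renaming (sum to ∑)
      open SumProperties M using (∑-single)

      -- Each vertex of W lies below exactly one root of W.
      ∑-roots-above : ∀ W {k} → lookup W k ≡ true → (x : Carrier) →
                      ∑ (λ m → if does (Root? W m) ∧ descᵇ T r m k then x else ε) ≈ x
      ∑-roots-above W {k} k∈W x with m , root , m≼k ← root-below W k∈W =
        ≈-trans (∑-single m _ others) (reflexive (cong (λ b → if b then x else ε) m-above))
        where
        m-above : does (Root? W m) ∧ descᵇ T r m k ≡ true
        m-above = Equivalence.from ∧-≡-true (dec-true (Root? W m) root , ≼⇒descᵇ m≼k)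
        others : ∀ j → j ≢ m → (if does (Root? W j) ∧ descᵇ T r j k then x else ε) ≈ ε
        others j j≢m with Root? W j | descᵇ T r j k in j≼ᵇk
        ... | no  _     | _     = ≈-refl
        ... | yes _     | false = ≈-refl
        ... | yes root′ | true  = ⊥-elim (j≢m (root-unique {W} root′ root (descᵇ⇒walk j≼ᵇk) m≼k))

    open RootsAbove +-0-commutativeMonoid using () renaming (∑-roots-above to sum-roots-above)
    open RootsAbove *-1-commutativeMonoid using () renaming (∑-roots-above to product-roots-above)

    -- Linear extensions and the hook length formula

    descendantsIn : Subset n → Fin n → ℕ
    descendantsIn W j = count (λ k → lookup W k ∧ descᵇ T r j k)

    treeFact≡∏ : ∀ W → treeFact T W r ≡ product (λ j → if lookup W j then descendantsIn W j else 1)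
    treeFact≡∏ W = prodOver≡∏ (lookup W) (descendantsIn W)

    descᵇ-false : ∀ {j k} → ¬ j ≼ k → descᵇ T r j k ≡ false
    descᵇ-false j⋠k = B.¬-not (j⋠k ∘ descᵇ⇒walk)

    descendantsIn-remove : ∀ W {m j} → ¬ j ≼ m → descendantsIn (W [ m ]≔ false) j ≡ descendantsIn W j
    descendantsIn-remove W {m} {j} j⋠m = count-cong same
      where
      same : ∀ k → (lookup (W [ m ]≔ false) k ∧ descᵇ T r j k) ≡ (lookup W k ∧ descᵇ T r j k)
      same k with k ≟ m
      ... | yes refl rewrite lookup∘update k W false | descᵇ-false j⋠m = sym (B.∧-zeroʳ (lookup W k))
      ... | no  k≢m  = cong (_∧ descᵇ T r j k) (lookup∘update′ k≢m W false)

    treeFact-remove-root : ∀ W {m} → Root W m → treeFact T W r ≡ descendantsIn W m * treeFact T (W [ m ]≔ false) r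
    treeFact-remove-root W {m} (m∈W , m-min) = begin
      treeFact T W r                                 ≡⟨ treeFact≡∏ W ⟩
      product (factor W)                             ≡⟨ product-extract m unchanged removed ⟩
      factor W m * product (factor W′)               ≡⟨ cong₂ _*_ (cong (λ b → if b then descendantsIn W m else 1) m∈W) (sym (treeFact≡∏ W′)) ⟩
      descendantsIn W m * treeFact T W′ r            ∎
      where
      open ≡-Reasoning
      W′ = W [ m ]≔ false
      factor : Subset n → Fin n → ℕ
      factor V j = if lookup V j then descendantsIn V j else 1
      removed : factor W′ m ≡ 1
      removed rewrite lookup∘update m W false = refl
      unchanged : ∀ j → j ≢ m → factor W j ≡ factor W′ j
      unchanged j j≢m rewrite lookup∘update′ j≢m W false with lookup W j in j∈W
      ... | true  = sym (descendantsIn-remove W (j≢m ∘ m-min j j∈W))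
      ... | false = refl

    ∑-roots-descendantsIn : ∀ W → sum (λ m → if does (Root? W m) then descendantsIn W m else 0) ≡ ∣ W ∣
    ∑-roots-descendantsIn W = begin
      sum (λ m → if does (Root? W m) then descendantsIn W m else 0)  ≡⟨ sum-cong-≗ expand ⟩
      sum (λ m → sum (λ k → below m k))                               ≡⟨ ∑-comm below ⟩
      sum (λ k → sum (λ m → below m k))                               ≡⟨ sum-cong-≗ one-root ⟩
      sum (indicator ∘ lookup W)                                      ≡⟨ ∣p∣≡∑indicator W ⟨
      ∣ W ∣                                                           ∎
      where
      open ≡-Reasoning
      below : Fin n → Fin n → ℕ
      below m k = if lookup W k then (if does (Root? W m) ∧ descᵇ T r m k then 1 else 0) else 0

      expand : ∀ m → (if does (Root? W m) then descendantsIn W m else 0)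
                   ≡ sum (λ k → if lookup W k then (if does (Root? W m) ∧ descᵇ T r m k then 1 else 0) else 0)
      expand m with Root? W m
      ... | yes _ = trans (count≡∑ (λ k → lookup W k ∧ descᵇ T r m k)) (sum-cong-≗ λ k → B.if-∧ (lookup W k))
      ... | no  _ = sym (sum-zero {n} _ λ k → B.if-eta (lookup W k))

      one-root : ∀ k → sum (λ m → below m k) ≡ indicator (lookup W k)
      one-root k with lookup W k in k∈W
      ... | false = sum-zero {n} (λ _ → 0) (λ _ → refl)
      ... | true  = sum-roots-above W k∈W 1

    -- The number of orderings of W in which every vertex comes after its ancestors, by recursion
    -- on the first vertex, which is a root of W; the first argument is fuel.
    linearExtensions : ℕ → Subset n → ℕ
    linearExtensions zero    W = 1
    linearExtensions (suc s) W = sum (λ m → if does (Root? W m) then linearExtensions s (W [ m ]≔ false) else 0)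

    e : Subset n → ℕ
    e W = linearExtensions ∣ W ∣ W

    ∣W∣≡1+∣W-root∣ : ∀ W {m} → Root W m → ∣ W ∣ ≡ suc ∣ W [ m ]≔ false ∣
    ∣W∣≡1+∣W-root∣ W (m∈W , _) = ∣p∣≡1+∣p[i]≔false∣ W m∈W

    e-unfold : ∀ {W s} → ∣ W ∣ ≡ suc s → e W ≡ sum (λ m → if does (Root? W m) then e (W [ m ]≔ false) else 0)
    e-unfold {W} {s} ∣W∣≡1+s rewrite ∣W∣≡1+s = sum-cong-≗ same-fuel
      where
      same-fuel : ∀ m → (if does (Root? W m) then linearExtensions s (W [ m ]≔ false) else 0)
                      ≡ (if does (Root? W m) then e (W [ m ]≔ false) else 0)
      same-fuel m with Root? W m
      ... | yes root = cong (λ s → linearExtensions s (W [ m ]≔ false)) (ℕ.suc-injective (trans (sym ∣W∣≡1+s) (∣W∣≡1+∣W-root∣ W root)))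
      ... | no  _    = refl

    e⊥ : e (⊥ {n}) ≡ 1
    e⊥ rewrite ∣⊥∣≡0 n = refl

    treeFact⊥ : treeFact T ⊥ r ≡ 1
    treeFact⊥ = trans (treeFact≡∏ ⊥) (product-one _ (λ j → cong (λ b → if b then descendantsIn ⊥ j else 1) (lookup-replicate j false)))

    e*treeFact≡∣W∣! : ∀ s W → ∣ W ∣ ≡ s → e W * treeFact T W r ≡ s !
    e*treeFact≡∣W∣! zero W ∣W∣≡0 with refl ← ∣p∣≡0⇒p≡⊥ W ∣W∣≡0 = cong₂ _*_ e⊥ treeFact⊥
    e*treeFact≡∣W∣! (suc s) W ∣W∣≡1+s = begin
      e W * treeFact T W r
        ≡⟨ cong (_* treeFact T W r) (e-unfold ∣W∣≡1+s) ⟩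
      sum (λ m → if does (Root? W m) then e (W [ m ]≔ false) else 0) * treeFact T W r
        ≡⟨ *-distribʳ-sum {n} (treeFact T W r) _ ⟩
      sum (λ m → (if does (Root? W m) then e (W [ m ]≔ false) else 0) * treeFact T W r)
        ≡⟨ sum-cong-≗ remove-root ⟩
      sum (λ m → s ! * (if does (Root? W m) then descendantsIn W m else 0))
        ≡⟨ *-distribˡ-sum {n} (s !) _ ⟨
      s ! * sum (λ m → if does (Root? W m) then descendantsIn W m else 0)
        ≡⟨ cong (s ! *_) (trans (∑-roots-descendantsIn W) ∣W∣≡1+s) ⟩
      s ! * suc s
        ≡⟨ *-comm (s !) (suc s) ⟩
      suc s !
        ∎
      where
      open ≡-Reasoning
      remove-root : ∀ m → (if does (Root? W m) then e (W [ m ]≔ false) else 0) * treeFact T W r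
                        ≡ s ! * (if does (Root? W m) then descendantsIn W m else 0)
      remove-root m with Root? W m
      ... | no  _    = sym (*-zeroʳ (s !))
      ... | yes root = begin
        e W′ * treeFact T W r                    ≡⟨ cong (e W′ *_) (treeFact-remove-root W root) ⟩
        e W′ * (descendantsIn W m * treeFact T W′ r) ≡⟨ x∙yz≈y∙xz (e W′) (descendantsIn W m) (treeFact T W′ r) ⟩
        descendantsIn W m * (e W′ * treeFact T W′ r) ≡⟨ cong (descendantsIn W m *_) (e*treeFact≡∣W∣! s W′ ∣W′∣≡s) ⟩
        descendantsIn W m * s !                  ≡⟨ *-comm _ (s !) ⟩
        s ! * descendantsIn W m                  ∎
        where
        W′ = W [ m ]≔ false
        ∣W′∣≡s = ℕ.suc-injective (trans (sym (∣W∣≡1+∣W-root∣ W root)) ∣W∣≡1+s)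
        open CommutativeSemigroupProperties ℕ.*-commutativeSemigroup using (x∙yz≈y∙xz)

    -- Cutting linear extensions

    Ideal : Subset n → Subset n → Set
    Ideal W S = (∀ k → lookup S k ≡ true → lookup W k ≡ true)
              × (∀ j k → lookup W j ≡ true → lookup S k ≡ true → j ≼ k → lookup S j ≡ true)

    opaque
      Ideal? : (W S : Subset n) → Dec (Ideal W S)
      Ideal? W S =
        all? (λ k → (lookup S k B.≟ true) →-dec (lookup W k B.≟ true)) ×-dec
        all? (λ j → all? (λ k → (lookup W j B.≟ true) →-dec ((lookup S k B.≟ true) →-dec
                                ((j ≼? k) →-dec (lookup S j B.≟ true)))))

    SizedIdeal : ℕ → Subset n → Subset n → Set
    SizedIdeal i W S = Ideal W S × ∣ S ∣ ≡ i

    opaque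
      SizedIdeal? : ∀ i W S → Dec (SizedIdeal i W S)
      SizedIdeal? i W S = Ideal? W S ×-dec (∣ S ∣ ℕ.≟ i)

    -- m is the first vertex of the S-part of a linear extension of W cut after S
    RootedIdeal : ℕ → Subset n → Subset n → Fin n → Set
    RootedIdeal i W S m = SizedIdeal (suc i) W S × Root S m

    RootedIdeal? : ∀ i W S m → Dec (RootedIdeal i W S m)
    RootedIdeal? i W S m = SizedIdeal? (suc i) W S ×-dec Root? S m

    module _ {W J : Subset n} {m : Fin n} (m∉J : lookup J m ≡ false) where

      private
        J′ = J [ m ]≔ true
        W′ = W [ m ]≔ false

        ∈J′⁻ : ∀ {k} → lookup J′ k ≡ true → k ≡ m ⊎ lookup J k ≡ true
        ∈J′⁻ {k} k∈J′ with k ≟ m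
        ... | yes k≡m = inj₁ k≡m
        ... | no  k≢m = inj₂ (trans (sym (lookup∘update′ k≢m J true)) k∈J′)

        m∈J′ : lookup J′ m ≡ true
        m∈J′ = lookup∘update m J true

        ∈J′⁺ : ∀ {k} → lookup J k ≡ true → lookup J′ k ≡ true
        ∈J′⁺ {k} k∈J with k ≟ m
        ... | yes refl = m∈J′
        ... | no  k≢m  = trans (lookup∘update′ k≢m J true) k∈J

        ∈W′⁻ : ∀ {k} → lookup W′ k ≡ true → k ≢ m × lookup W k ≡ true
        ∈W′⁻ {k} k∈W′ with k ≟ m
        ... | yes refl = ⊥-elim (true≢false (trans (sym k∈W′) (lookup∘update k W false)))
        ... | no  k≢m  = k≢m , trans (sym (lookup∘update′ k≢m W false)) k∈W′

        ∈W′⁺ : ∀ {k} → k ≢ m → lookup W k ≡ true → lookup W′ k ≡ true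
        ∈W′⁺ k≢m k∈W = trans (lookup∘update′ k≢m W false) k∈W

        ∉J : ∀ {k} → lookup J k ≡ true → k ≢ m
        ∉J k∈J refl = true≢false (trans (sym k∈J) m∉J)

      ideal-with-root⇒ : Ideal W J′ → Root J′ m → Root W m × Ideal W′ J
      ideal-with-root⇒ (J′⊆W , J′-closed) (_ , m-min) =
        (J′⊆W m m∈J′ , λ j j∈W j≼m → m-min j (J′-closed j m j∈W m∈J′ j≼m) j≼m) ,
        (λ k k∈J → ∈W′⁺ (∉J k∈J) (J′⊆W k (∈J′⁺ k∈J))) ,
        λ j k j∈W′ k∈J j≼k → case ∈J′⁻ (J′-closed j k (proj₂ (∈W′⁻ j∈W′)) (∈J′⁺ k∈J) j≼k) of λ
          { (inj₁ j≡m) → ⊥-elim (proj₁ (∈W′⁻ j∈W′) j≡m)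
          ; (inj₂ j∈J) → j∈J }

      ideal-with-root⇐ : Root W m → Ideal W′ J → Ideal W J′ × Root J′ m
      ideal-with-root⇐ (m∈W , m-min) (J⊆W′ , J-closed) = (J′⊆W , J′-closed) , (m∈J′ , m-min′)
        where
        J′⊆W : ∀ k → lookup J′ k ≡ true → lookup W k ≡ true
        J′⊆W k k∈J′ with ∈J′⁻ k∈J′
        ... | inj₁ refl = m∈W
        ... | inj₂ k∈J  = proj₂ (∈W′⁻ (J⊆W′ k k∈J))
        J′-closed : ∀ j k → lookup W j ≡ true → lookup J′ k ≡ true → j ≼ k → lookup J′ j ≡ true
        J′-closed j k j∈W k∈J′ j≼k with j ≟ m | ∈J′⁻ k∈J′
        ... | yes refl | _         = m∈J′
        ... | no  j≢m  | inj₁ refl = ⊥-elim (j≢m (m-min j j∈W j≼k))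
        ... | no  j≢m  | inj₂ k∈J  = ∈J′⁺ (J-closed j k (∈W′⁺ j≢m j∈W) k∈J j≼k)
        m-min′ : ∀ j → lookup J′ j ≡ true → j ≼ m → j ≡ m
        m-min′ j j∈J′ j≼m with ∈J′⁻ j∈J′
        ... | inj₁ j≡m = j≡m
        ... | inj₂ j∈J = m-min j (proj₂ (∈W′⁻ (J⊆W′ j j∈J))) j≼m

      rooted-ideal⇔ : ∀ i → RootedIdeal i W J′ m ⇔ (Root W m × SizedIdeal i W′ J)
      rooted-ideal⇔ i = mk⇔
        (λ ((ideal , size) , root) → let (root′ , ideal′) = ideal-with-root⇒ ideal root in
          root′ , ideal′ , ℕ.suc-injective (trans (sym (∣p[i]≔true∣≡1+∣p∣ J m∉J)) size))
        (λ (root , ideal , size) → let (ideal′ , root′) = ideal-with-root⇐ root ideal in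
          (ideal′ , trans (∣p[i]≔true∣≡1+∣p∣ J m∉J) (cong suc size)) , root′)

      remove-inserted : J′ [ m ]≔ false ≡ J
      remove-inserted = trans ([]≔-idempotent J m) ([]≔-same J m∉J)

      ─-inserted : W ─ J′ ≡ W′ ─ J
      ─-inserted = lookup-injective same
        where
        same : ∀ k → lookup (W ─ J′) k ≡ lookup (W′ ─ J) k
        same k with k ≟ m | lookup J k in k∈J
        ... | yes refl | _     = trans (lookup-─-inside W J′ m∈J′) (sym (trans (lookup-─-outside W′ J m∉J) (lookup∘update k W false)))
        ... | no  k≢m  | true  = trans (lookup-─-inside W J′ (∈J′⁺ k∈J)) (sym (lookup-─-inside W′ J k∈J))
        ... | no  k≢m  | false = trans (lookup-─-outside W J′ (trans (lookup∘update′ k≢m J true) k∈J))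
                                   (sym (trans (lookup-─-outside W′ J k∈J) (lookup∘update′ k≢m W false)))

    ∑-split : ℕ → Subset n → ℕ
    ∑-split i W = ∑ₛ (λ S → if does (SizedIdeal? i W S) then e S * e (W ─ S) else 0)

    ⊥-sizedIdeal : ∀ W → SizedIdeal 0 W ⊥
    ⊥-sizedIdeal W = ((λ k k∈⊥ → ⊥-elim (true≢false (trans (sym k∈⊥) (lookup-replicate k false))))
               , λ j k _ k∈⊥ _ → ⊥-elim (true≢false (trans (sym k∈⊥) (lookup-replicate k false))))
              , ∣⊥∣≡0 n

    -- The bijection (S, m) ↦ (m, S [ m ]≔ false), removing the first vertex of a linear extension.
    ∑-split-suc : ∀ i W m → ∑ₛ (λ S → if does (RootedIdeal? i W S m) then e (S [ m ]≔ false) * e (W ─ S) else 0)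
                          ≡ (if does (Root? W m) then ∑-split i (W [ m ]≔ false) else 0)
    ∑-split-suc i W m = begin
      ∑ₛ (λ S → if does (cut? S) then e (S [ m ]≔ false) * e (W ─ S) else 0)
        ≡⟨ ∑ₛ-cong {n} m∈S ⟩
      ∑ₛ (λ S → if lookup S m then (if does (cut? S) then e (S [ m ]≔ false) * e (W ─ S) else 0) else 0)
        ≡⟨ ∑ₛ-insert m _ ⟩
      ∑ₛ (λ J → if lookup J m then 0 else (if does (cut? (J [ m ]≔ true)) then e ((J [ m ]≔ true) [ m ]≔ false) * e (W ─ (J [ m ]≔ true)) else 0))
        ≡⟨ ∑ₛ-cong {n} reindex ⟩
      ∑ₛ (λ J → if does (Root? W m) ∧ does (SizedIdeal? i W′ J) then e J * e (W′ ─ J) else 0)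
        ≡⟨ ∑ₛ-cong {n} (λ J → B.if-∧ (does (Root? W m))) ⟩
      ∑ₛ (λ J → if does (Root? W m) then (if does (SizedIdeal? i W′ J) then e J * e (W′ ─ J) else 0) else 0)
        ≡⟨ ∑ₛ-if {n} (does (Root? W m)) ⟩
      (if does (Root? W m) then ∑-split i W′ else 0)
        ∎
      where
      open ≡-Reasoning
      W′ = W [ m ]≔ false
      cut? : ∀ S → Dec (RootedIdeal i W S m)
      cut? S = RootedIdeal? i W S m

      m∈S : ∀ S → (if does (cut? S) then e (S [ m ]≔ false) * e (W ─ S) else 0)
                ≡ (if lookup S m then (if does (cut? S) then e (S [ m ]≔ false) * e (W ─ S) else 0) else 0)
      m∈S S with lookup S m in m∈?S
      ... | true  = refl
      ... | false rewrite dec-false (cut? S) (λ (_ , (m∈S , _)) → true≢false (trans (sym m∈S) m∈?S)) = refl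

      reindex : ∀ J → (if lookup J m then 0 else (if does (cut? (J [ m ]≔ true)) then e ((J [ m ]≔ true) [ m ]≔ false) * e (W ─ (J [ m ]≔ true)) else 0))
                    ≡ (if does (Root? W m ×-dec SizedIdeal? i W′ J) then e J * e (W′ ─ J) else 0)
      reindex J with lookup J m in m∈?J
      ... | true  with Root? W m | SizedIdeal? i W′ J
      ...   | no  _ | _                     = refl
      ...   | yes _ | no  _                 = refl
      ...   | yes _ | yes ((J⊆W′ , _) , _) = ⊥-elim (true≢false (trans (sym (J⊆W′ m m∈?J)) (lookup∘update m W false)))
      reindex J | false = cong₂ (λ b x → if b then x else 0)
        (does-⇔ (rooted-ideal⇔ {W} {J} {m} m∈?J i) (cut? (J [ m ]≔ true)) (Root? W m ×-dec SizedIdeal? i W′ J))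
        (cong₂ (λ S S′ → e S * e S′) (remove-inserted {W} {J} {m} m∈?J) (─-inserted {W} {J} {m} m∈?J))

    ∑-split-zero : ∀ W → ∑-split 0 W ≡ e W
    ∑-split-zero W = begin
      ∑-split 0 W                                             ≡⟨ ∑ₛ-only-⊥ _ only-⊥ ⟩
      (if does (SizedIdeal? 0 W ⊥) then e ⊥ * e (W ─ ⊥) else 0) ≡⟨ cong (λ b → if b then e ⊥ * e (W ─ ⊥) else 0) (dec-true (SizedIdeal? 0 W ⊥) (⊥-sizedIdeal W)) ⟩
      e ⊥ * e (W ─ ⊥)                                         ≡⟨ cong₂ _*_ e⊥ (cong e (p─⊥≡p W)) ⟩
      1 * e W                                                 ≡⟨ *-identityˡ (e W) ⟩
      e W                                                     ∎
      where
      open ≡-Reasoning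
      only-⊥ : ∀ S → S ≢ ⊥ → (if does (SizedIdeal? 0 W S) then e S * e (W ─ S) else 0) ≡ 0
      only-⊥ S S≢⊥ with SizedIdeal? 0 W S
      ... | no  _           = refl
      ... | yes (_ , ∣S∣≡0) = ⊥-elim (S≢⊥ (∣p∣≡0⇒p≡⊥ S ∣S∣≡0))

    split-first-vertex : ∀ i W S → (if does (SizedIdeal? (suc i) W S) then e S * e (W ─ S) else 0)
                                 ≡ sum (λ m → if does (RootedIdeal? i W S m) then e (S [ m ]≔ false) * e (W ─ S) else 0)
    split-first-vertex i W S with SizedIdeal? (suc i) W S
    ... | no  _              = sym (sum-zero {n} (λ _ → 0) (λ _ → refl))
    ... | yes (_ , ∣S∣≡1+i) = begin
      e S * e (W ─ S)
        ≡⟨ cong (_* e (W ─ S)) (e-unfold ∣S∣≡1+i) ⟩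
      sum (λ m → if does (Root? S m) then e (S [ m ]≔ false) else 0) * e (W ─ S)
        ≡⟨ *-distribʳ-sum {n} (e (W ─ S)) _ ⟩
      sum (λ m → (if does (Root? S m) then e (S [ m ]≔ false) else 0) * e (W ─ S))
        ≡⟨ sum-cong-≗ (λ m → B.if-float (_* e (W ─ S)) (does (Root? S m))) ⟩
      sum (λ m → if does (Root? S m) then e (S [ m ]≔ false) * e (W ─ S) else 0)
        ∎
      where open ≡-Reasoning

    -- Cutting a linear extension of W after its i-th vertex gives linear extensions of an
    -- i-element ideal S of W and of W ─ S.
    ∑-split≡e : ∀ i W → i ≤ ∣ W ∣ → ∑-split i W ≡ e W
    ∑-split≡e zero    W _         = ∑-split-zero W
    ∑-split≡e (suc i) W 1+i≤∣W∣ = begin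
      ∑-split (suc i) W
        ≡⟨ ∑ₛ-cong {n} (split-first-vertex i W) ⟩
      ∑ₛ (λ S → sum (λ m → if does (RootedIdeal? i W S m) then e (S [ m ]≔ false) * e (W ─ S) else 0))
        ≡⟨ ∑ₛ-comm (λ S m → if does (RootedIdeal? i W S m) then e (S [ m ]≔ false) * e (W ─ S) else 0) ⟩
      sum (λ m → ∑ₛ (λ S → if does (RootedIdeal? i W S m) then e (S [ m ]≔ false) * e (W ─ S) else 0))
        ≡⟨ sum-cong-≗ (∑-split-suc i W) ⟩
      sum (λ m → if does (Root? W m) then ∑-split i (W [ m ]≔ false) else 0)
        ≡⟨ sum-cong-≗ induction ⟩
      sum (λ m → if does (Root? W m) then e (W [ m ]≔ false) else 0)
        ≡⟨ e-unfold ∣W∣≡1+s ⟨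
      e W
        ∎
      where
      open ≡-Reasoning
      s = pred ∣ W ∣
      ∣W∣≡1+s : ∣ W ∣ ≡ suc s
      ∣W∣≡1+s = sym (suc-pred ∣ W ∣ {{>-nonZero (≤-<-trans z≤n 1+i≤∣W∣)}})

      induction : ∀ m → (if does (Root? W m) then ∑-split i (W [ m ]≔ false) else 0)
                      ≡ (if does (Root? W m) then e (W [ m ]≔ false) else 0)
      induction m with Root? W m
      ... | no  _    = refl
      ... | yes root = ∑-split≡e i (W [ m ]≔ false)
                         (subst (i ≤_) (ℕ.suc-injective (trans (sym ∣W∣≡1+s) (∣W∣≡1+∣W-root∣ W root))) (pred-mono-≤ 1+i≤∣W∣))

    -- Rooted subtrees and their difference forests

    V : Subset n
    V = fullSet

    ∈V : ∀ k → lookup V k ≡ true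
    ∈V = lookup∘tabulate (λ _ → true)

    ∣V∣≡n : ∣ V ∣ ≡ n
    ∣V∣≡n = trans (cong ∣_∣ (lookup-injective {p = V} {q = replicate n true} λ k → trans (∈V k) (sym (lookup-replicate k true)))) (∣⊤∣≡n n)

    ParentClosed : Subset n → Set
    ParentClosed U = ∀ k → lookup U k ≡ true → k ≢ r → lookup U (T k) ≡ true

    parent-closed⇒ideal : ∀ {U} → lookup U r ≡ true → ParentClosed U → Ideal V U
    parent-closed⇒ideal {U} r∈U closed = (λ k _ → ∈V k) , λ j k _ k∈U j≼k → climb k∈U j≼k
      where
      climb : ∀ {j k} → lookup U k ≡ true → j ≼ k → lookup U j ≡ true
      climb k∈U stop             = k∈U
      climb k∈U (step k≢r j≼Tk) = climb (closed _ k∈U k≢r) j≼Tk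

    isEmptyᵇ⇔≡⊥ : ∀ U → Bool.T (isEmptyᵇ U) ⇔ U ≡ ⊥
    isEmptyᵇ⇔≡⊥ U = mk⇔
      (λ empty → lookup-injective {q = ⊥ {n}} λ k → trans (Equivalence.to T-not-≡ (Equivalence.to (all-allFin (λ k → not (lookup U k))) empty k))
                                             (sym (lookup-replicate k false)))
      (λ { refl → Equivalence.from (all-allFin (λ k → not (lookup (⊥ {n}) k))) λ k → Equivalence.from T-not-≡ (lookup-replicate k false) })

    ideal-without-root : ∀ {U} → Ideal V U → lookup U r ≡ false → U ≡ ⊥
    ideal-without-root {U} (_ , U-closed) r∉U = lookup-injective {q = ⊥} outside
      where
      outside : ∀ k → lookup U k ≡ lookup (⊥ {n}) k
      outside k with lookup U k in k∈?U
      ... | true  = ⊥-elim (true≢false (trans (sym (U-closed r k (∈V r) k∈?U (r≼ k))) r∉U))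
      ... | false = sym (lookup-replicate k false)

    ideal⇒parent-closed : ∀ {U} → Ideal V U → ParentClosed U
    ideal⇒parent-closed (_ , U-closed) k k∈U k≢r = U-closed (T k) k (∈V (T k)) k∈U (parent≼ k≢r)

    parent-step⇔ : ∀ U k → Bool.T (not (lookup U k ∧ not (k == r)) ∨ lookup U (T k))
                         ⇔ (lookup U k ≡ true → k ≢ r → lookup U (T k) ≡ true)
    parent-step⇔ U k with lookup U k | k ≟ r | lookup U (T k)
    ... | false | _        | _     = mk⇔ (λ _ ()) _
    ... | true  | yes k≡r  | _     = mk⇔ (λ _ _ k≢r → ⊥-elim (k≢r k≡r)) _
    ... | true  | no  _    | true  = mk⇔ (λ _ _ _ → refl) _
    ... | true  | no  k≢r  | false = mk⇔ (λ ()) (λ closed → true≢false (sym (closed refl k≢r)))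

    isRootedSubsetᵇ⇔ : ∀ U → Bool.T (isRootedSubsetᵇ T r U) ⇔ (lookup U r ≡ true × ParentClosed U)
    isRootedSubsetᵇ⇔ U = mk⇔
      (λ rooted → let (r∈U , closed) = Equivalence.to (T-∧ {lookup U r}) rooted in
        Equivalence.to T-≡ r∈U , λ k → Equivalence.to (parent-step⇔ U k) (Equivalence.to (all-allFin parent-step) closed k))
      (λ (r∈U , closed) → Equivalence.from (T-∧ {lookup U r})
        (Equivalence.from T-≡ r∈U , Equivalence.from (all-allFin parent-step) λ k → Equivalence.from (parent-step⇔ U k) (closed k)))
      where
      parent-step : Fin n → Bool
      parent-step k = not (lookup U k ∧ not (k == r)) ∨ lookup U (T k)

    subtree⇔ideal : ∀ U → Bool.T (isSubtreeᵇ T r U) ⇔ Ideal V U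
    subtree⇔ideal U = mk⇔ to from
      where
      to : Bool.T (isSubtreeᵇ T r U) → Ideal V U
      to subtree with Equivalence.to (T-∨ {isEmptyᵇ U}) subtree
      ... | inj₁ empty  with refl ← Equivalence.to (isEmptyᵇ⇔≡⊥ U) empty = proj₁ (⊥-sizedIdeal V)
      ... | inj₂ rooted with r∈U , closed ← Equivalence.to (isRootedSubsetᵇ⇔ U) rooted = parent-closed⇒ideal {U} r∈U closed
      from : Ideal V U → Bool.T (isSubtreeᵇ T r U)
      from ideal with lookup U r B.≟ true
      ... | no  r∉U = Equivalence.from (T-∨ {isEmptyᵇ U}) (inj₁ (Equivalence.from (isEmptyᵇ⇔≡⊥ U) (ideal-without-root ideal (B.¬-not r∉U))))
      ... | yes r∈U = Equivalence.from (T-∨ {isEmptyᵇ U}) (inj₂ (Equivalence.from (isRootedSubsetᵇ⇔ U) (r∈U , ideal⇒parent-closed {U} ideal)))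

    subtreeFact≡treeFact : ∀ U → subtreeFact T r U ≡ treeFact T U r
    subtreeFact≡treeFact U with isEmptyᵇ U in empty
    ... | false = refl
    ... | true  with refl ← Equivalence.to (isEmptyᵇ⇔≡⊥ U) (Equivalence.from T-≡ empty) = sym treeFact⊥

    treeFact-subtree : ∀ j → treeFact T (subtreeSet T r j) j ≡ product (λ j′ → if descᵇ T r j j′ then descendantsIn V j′ else 1)
    treeFact-subtree j = trans (prodOver≡∏ (lookup Uⱼ) _) (product-cong-≗ factor)
      where
      Uⱼ = subtreeSet T r j
      ∈Uⱼ : ∀ k → lookup Uⱼ k ≡ descᵇ T r j k
      ∈Uⱼ = lookup∘tabulate (descᵇ T r j)
      factor : ∀ j′ → (if lookup Uⱼ j′ then count (λ k → lookup Uⱼ k ∧ descᵇ T j j′ k) else 1)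
                    ≡ (if descᵇ T r j j′ then descendantsIn V j′ else 1)
      factor j′ rewrite ∈Uⱼ j′ with descᵇ T r j j′ in j≼ᵇj′
      ... | false = refl
      ... | true  = count-cong λ k → B.⇔→≡ (mk⇔
        (λ in-subtree → let (j∈Uⱼ , j′≼ᵇk) = Equivalence.to ∧-≡-true in-subtree in
          Equivalence.from ∧-≡-true (∈V k , ≼⇒descᵇ (proj₁ (descᵇ-within⇒≼ (descᵇ⇒walk (trans (sym (∈Uⱼ k)) j∈Uⱼ)) j′≼ᵇk))))
        (λ below-j′ → let j′≼k = descᵇ⇒walk (proj₂ (Equivalence.to ∧-≡-true below-j′)) in
          Equivalence.from ∧-≡-true (trans (∈Uⱼ k) (≼⇒descᵇ (walk-trans j≼j′ j′≼k)) , ≼⇒descᵇ-within j′≼k j≼j′)))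
        where j≼j′ = descᵇ⇒walk j≼ᵇj′

    DescendantClosed : Subset n → Set
    DescendantClosed W = ∀ j k → lookup W j ≡ true → j ≼ k → lookup W k ≡ true

    descendantsIn-closed : ∀ {W j} → DescendantClosed W → lookup W j ≡ true → descendantsIn W j ≡ descendantsIn V j
    descendantsIn-closed {W} {j} closed j∈W = count-cong same
      where
      same : ∀ k → (lookup W k ∧ descᵇ T r j k) ≡ (lookup V k ∧ descᵇ T r j k)
      same k with descᵇ T r j k in j≼ᵇk
      ... | true  = trans (cong (_∧ true) (closed j k j∈W (descᵇ⇒walk j≼ᵇk))) (cong (_∧ true) (sym (∈V k)))
      ... | false = trans (B.∧-zeroʳ (lookup W k)) (sym (B.∧-zeroʳ (lookup V k)))

    ∏-roots : ∀ {W} → DescendantClosed W → (c : Fin n → ℕ) →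
      product (λ j → if does (Root? W j) then product (λ j′ → if descᵇ T r j j′ then c j′ else 1) else 1)
        ≡ product (λ j′ → if lookup W j′ then c j′ else 1)
    ∏-roots {W} closed c = begin
      product (λ j → if does (Root? W j) then product (λ j′ → if descᵇ T r j j′ then c j′ else 1) else 1)
        ≡⟨ product-cong-≗ spread ⟩
      product (λ j → product (λ j′ → factor j j′))
        ≡⟨ ∏-comm factor ⟩
      product (λ j′ → product (λ j → factor j j′))
        ≡⟨ product-cong-≗ collect ⟩
      product (λ j′ → if lookup W j′ then c j′ else 1)
        ∎
      where
      open ≡-Reasoning
      factor : Fin n → Fin n → ℕ
      factor j j′ = if does (Root? W j) ∧ descᵇ T r j j′ then c j′ else 1

      spread : ∀ j → (if does (Root? W j) then product (λ j′ → if descᵇ T r j j′ then c j′ else 1) else 1)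
                   ≡ product (λ j′ → if does (Root? W j) ∧ descᵇ T r j j′ then c j′ else 1)
      spread j with Root? W j
      ... | yes _ = refl
      ... | no  _ = sym (product-one {n} (λ _ → 1) (λ _ → refl))

      collect : ∀ j′ → product (λ j → if does (Root? W j) ∧ descᵇ T r j j′ then c j′ else 1) ≡ (if lookup W j′ then c j′ else 1)
      collect j′ with lookup W j′ in j′∈?W
      ... | false = product-one _ outside
        where
        outside : ∀ j → (if does (Root? W j) ∧ descᵇ T r j j′ then c j′ else 1) ≡ 1
        outside j with Root? W j | descᵇ T r j j′ in j≼ᵇj′
        ... | no  _           | _     = refl
        ... | yes _           | false = refl
        ... | yes (j∈W , _)   | true  = ⊥-elim (true≢false (trans (sym (closed j j′ j∈W (descᵇ⇒walk j≼ᵇj′))) j′∈?W))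
      ... | true  = product-roots-above W j′∈?W (c j′)

    treeFact-forest : ∀ {W} → DescendantClosed W →
      treeFact T W r ≡ product (λ j → if does (Root? W j) then treeFact T (subtreeSet T r j) j else 1)
    treeFact-forest {W} closed = begin
      treeFact T W r
        ≡⟨ treeFact≡∏ W ⟩
      product (λ j′ → if lookup W j′ then descendantsIn W j′ else 1)
        ≡⟨ product-cong-≗ in-V ⟩
      product (λ j′ → if lookup W j′ then descendantsIn V j′ else 1)
        ≡⟨ ∏-roots closed (descendantsIn V) ⟨
      product (λ j → if does (Root? W j) then product (λ j′ → if descᵇ T r j j′ then descendantsIn V j′ else 1) else 1)
        ≡⟨ product-cong-≗ (λ j → cong (λ x → if does (Root? W j) then x else 1) (treeFact-subtree j)) ⟨
      product (λ j → if does (Root? W j) then treeFact T (subtreeSet T r j) j else 1)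
        ∎
      where
      open ≡-Reasoning
      in-V : ∀ j′ → (if lookup W j′ then descendantsIn W j′ else 1) ≡ (if lookup W j′ then descendantsIn V j′ else 1)
      in-V j′ with lookup W j′ in j′∈W
      ... | true  = descendantsIn-closed {W} closed j′∈W
      ... | false = refl

    ∈V─ : ∀ U k → lookup (V ─ U) k ≡ not (lookup U k)
    ∈V─ U k with lookup U k in k∈?U
    ... | true  = lookup-─-inside V U k∈?U
    ... | false = trans (lookup-─-outside V U k∈?U) (∈V k)

    complement-closed : ∀ {U} → Ideal V U → DescendantClosed (V ─ U)
    complement-closed {U} (_ , U-closed) j k j∉U j≼k with lookup U k in k∈?U
    ... | false = trans (∈V─ U k) (cong not k∈?U)
    ... | true  = ⊥-elim (true≢false (trans (sym (U-closed j k (∈V j) k∈?U j≼k)) (B.not-injective (trans (sym (∈V─ U j)) j∉U))))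

    roots-of-complement : ∀ {U} → Ideal V U → lookup U r ≡ true →
      ∀ j → (not (lookup U j) ∧ not (j == r) ∧ lookup U (T j)) ≡ does (Root? (V ─ U) j)
    roots-of-complement {U} (_ , U-closed) r∈U j with lookup U j in j∈?U | j ≟ r | lookup U (T j) in Tj∈?U
    ... | true  | _       | _     = sym (dec-false (Root? (V ─ U) j) λ (j∈W , _) → true≢false (trans (sym j∈W) (trans (∈V─ U j) (cong not j∈?U))))
    ... | false | yes refl | _    = ⊥-elim (true≢false (trans (sym r∈U) j∈?U))
    ... | false | no  j≢r | false = sym (dec-false (Root? (V ─ U) j) λ (_ , j-min) →
                                      parent≢ j≢r (j-min (T j) (trans (∈V─ U (T j)) (cong not Tj∈?U)) (parent≼ j≢r)))
    ... | false | no  j≢r | true  = sym (dec-true (Root? (V ─ U) j) (trans (∈V─ U j) (cong not j∈?U) , j-min))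
      where
      j-min : ∀ i → lookup (V ─ U) i ≡ true → i ≼ j → i ≡ j
      j-min i i∈W i≼j with ≼-unstep j≢r i≼j
      ... | inj₁ i≡j  = i≡j
      ... | inj₂ i≼Tj = ⊥-elim (true≢false (trans (sym (U-closed i (T j) (∈V i) Tj∈?U i≼Tj))
                                                  (B.not-injective (trans (sym (∈V─ U i)) i∈W))))

    forestFact≡treeFact : ∀ U → Ideal V U → forestFact T r U ≡ treeFact T (V ─ U) r
    forestFact≡treeFact U ideal with isEmptyᵇ U in empty
    ... | true  with refl ← Equivalence.to (isEmptyᵇ⇔≡⊥ U) (Equivalence.from T-≡ empty) = cong (λ W → treeFact T W r) (sym (p─⊥≡p V))
    ... | false = begin
      prodOver (λ j → not (j ∈ᵇ U) ∧ not (j == r) ∧ (T j ∈ᵇ U)) (λ j → treeFact T (subtreeSet T r j) j)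
        ≡⟨ prodOver≡∏ (λ j → not (j ∈ᵇ U) ∧ not (j == r) ∧ (T j ∈ᵇ U)) (λ j → treeFact T (subtreeSet T r j) j) ⟩
      product (λ j → if not (lookup U j) ∧ not (j == r) ∧ lookup U (T j) then treeFact T (subtreeSet T r j) j else 1)
        ≡⟨ product-cong-≗ (λ j → cong (λ b → if b then treeFact T (subtreeSet T r j) j else 1) (roots-of-complement ideal r∈U j)) ⟩
      product (λ j → if does (Root? (V ─ U) j) then treeFact T (subtreeSet T r j) j else 1)
        ≡⟨ treeFact-forest (complement-closed ideal) ⟨
      treeFact T (V ─ U) r
        ∎
      where
      open ≡-Reasoning
      r∈U : lookup U r ≡ true
      r∈U with lookup U r in r∈?U
      ... | true  = refl
      ... | false = ⊥-elim (subst Bool.T empty (Equivalence.from (isEmptyᵇ⇔≡⊥ U) (ideal-without-root ideal r∈?U)))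

    ∣V─U∣≡n∸∣U∣ : ∀ U → ∣ V ─ U ∣ ≡ n ∸ ∣ U ∣
    ∣V─U∣≡n∸∣U∣ U = trans (cong ∣_∣ (lookup-injective {p = V ─ U} {q = ∁ U} λ k → trans (∈V─ U k) (sym (lookup-map k not U)))) (∣∁p∣≡n∸∣p∣ U)

    weight : Subset n → ℕ
    weight U = if does (Ideal? V U) then (n C ∣ U ∣) * (e U * e (V ─ U)) else 0

    weight*treeFacts≡n! : ∀ {U} → Ideal V U → weight U * (treeFact T U r * treeFact T (V ─ U) r) ≡ n !
    weight*treeFacts≡n! {U} ideal rewrite dec-true (Ideal? V U) ideal = begin
      (n C ∣ U ∣) * (e U * e (V ─ U)) * (treeFact T U r * treeFact T (V ─ U) r)
        ≡⟨ interchange (n C ∣ U ∣) (e U) (e (V ─ U)) (treeFact T U r) (treeFact T (V ─ U) r) ⟩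
      (n C ∣ U ∣) * ((e U * treeFact T U r) * (e (V ─ U) * treeFact T (V ─ U) r))
        ≡⟨ cong (λ x → (n C ∣ U ∣) * x) (cong₂ _*_ (e*treeFact≡∣W∣! ∣ U ∣ U refl) (e*treeFact≡∣W∣! (n ∸ ∣ U ∣) (V ─ U) (∣V─U∣≡n∸∣U∣ U))) ⟩
      (n C ∣ U ∣) * (∣ U ∣ ! * (n ∸ ∣ U ∣) !)
        ≡⟨ C*k!*[n∸k]!≡n! (∣p∣≤n U) ⟩
      n !
        ∎
      where
      open ≡-Reasoning
      interchange : ∀ (c x y a b : ℕ) → c * (x * y) * (a * b) ≡ c * ((x * a) * (y * b))
      interchange = ℕ-Solver.solve-∀

    weight≡∑-sizes : ∀ U → weight U ≡ sum {suc n} (λ i → (n C toℕ i) * (if does (SizedIdeal? (toℕ i) V U) then e U * e (V ─ U) else 0))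
    weight≡∑-sizes U with Ideal? V U
    ... | no ¬ideal = sym (sum-zero {suc n} _ λ i → trans (cong (λ b → (n C toℕ i) * (if b then e U * e (V ─ U) else 0))
                                                        (dec-false (SizedIdeal? (toℕ i) V U) (¬ideal ∘ proj₁)))
                                                  (*-zeroʳ (n C toℕ i)))
    ... | yes ideal = sym (trans (sum-single i₀ _ others) at-i₀)
      where
      i₀ : Fin (suc n)
      i₀ = fromℕ< (s≤s (∣p∣≤n U))
      toℕ-i₀ : toℕ i₀ ≡ ∣ U ∣
      toℕ-i₀ = toℕ-fromℕ< (s≤s (∣p∣≤n U))
      at-i₀ : (n C toℕ i₀) * (if does (SizedIdeal? (toℕ i₀) V U) then e U * e (V ─ U) else 0) ≡ (n C ∣ U ∣) * (e U * e (V ─ U))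
      at-i₀ rewrite dec-true (SizedIdeal? (toℕ i₀) V U) (ideal , sym toℕ-i₀) = cong (λ k → (n C k) * (e U * e (V ─ U))) toℕ-i₀
      others : ∀ i → i ≢ i₀ → (n C toℕ i) * (if does (SizedIdeal? (toℕ i) V U) then e U * e (V ─ U) else 0) ≡ 0
      others i i≢i₀ rewrite dec-false (SizedIdeal? (toℕ i) V U) (λ (_ , ∣U∣≡i) → i≢i₀ (toℕ-injective (trans (sym ∣U∣≡i) (sym toℕ-i₀))))
        = *-zeroʳ (n C toℕ i)

    ∑-weight≡2^n*e : ∑ₛ weight ≡ 2 ^ n * e V
    ∑-weight≡2^n*e = begin
      ∑ₛ weight
        ≡⟨ ∑ₛ-cong {n} weight≡∑-sizes ⟩
      ∑ₛ (λ U → sum {suc n} (λ i → (n C toℕ i) * term i U))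
        ≡⟨ ∑ₛ-comm (λ U i → (n C toℕ i) * term i U) ⟩
      sum {suc n} (λ i → ∑ₛ (λ U → (n C toℕ i) * term i U))
        ≡⟨ sum-cong-≗ {suc n} (λ i → sym (*-distribˡ-∑ₛ (n C toℕ i) (term i))) ⟩
      sum {suc n} (λ i → (n C toℕ i) * ∑-split (toℕ i) V)
        ≡⟨ sum-cong-≗ {suc n} (λ i → cong ((n C toℕ i) *_) (∑-split≡e (toℕ i) V (subst (toℕ i ≤_) (sym ∣V∣≡n) (toℕ≤pred[n] i)))) ⟩
      sum {suc n} (λ i → (n C toℕ i) * e V)
        ≡⟨ *-distribʳ-sum {suc n} (e V) (λ i → n C toℕ i) ⟨
      sum {suc n} (λ i → n C toℕ i) * e V
        ≡⟨ cong (_* e V) (∑-binomial≡2^ n) ⟩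
      2 ^ n * e V
        ∎
      where
      open ≡-Reasoning
      term : Fin (suc n) → Subset n → ℕ
      term i U = if does (SizedIdeal? (toℕ i) V U) then e U * e (V ─ U) else 0

    e[V]*treeFact≡n! : e V * treeFact T V r ≡ n !
    e[V]*treeFact≡n! = e*treeFact≡∣W∣! n V ∣V∣≡n

    -- e V = D + 1 is the common denominator of the tree binomials.
    D : ℕ
    D = pred (e V)

    e[V]≡1+D : e V ≡ suc D
    e[V]≡1+D = sym (suc-pred (e V) {{m*n≢0⇒m≢0 (e V) {{subst NonZero (sym e[V]*treeFact≡n!) (n !≢0)}}}})

    subtree≡ideal : ∀ U → isSubtreeᵇ T r U ≡ does (Ideal? V U)
    subtree≡ideal U = ⇔-does (subtree⇔ideal U) (Ideal? V U)

    treeBinom≡weight : ∀ U → Ideal V U → treeBinom T r U ≡ weight U /1+ D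
    treeBinom≡weight U ideal = begin
      frac (treeFact T V r) (subtreeFact T r U * forestFact T r U)
        ≡⟨ cong₂ (λ x y → frac (treeFact T V r) (x * y)) (subtreeFact≡treeFact U) (forestFact≡treeFact U ideal) ⟩
      frac (treeFact T V r) (treeFact T U r * treeFact T (V ─ U) r)
        ≡⟨ frac≡/1+ {c = weight U} D treeFacts≢0 cross-multiplied ⟩
      weight U /1+ D
        ∎
      where
      open ≡-Reasoning
      cross-multiplied : treeFact T V r * suc D ≡ weight U * (treeFact T U r * treeFact T (V ─ U) r)
      cross-multiplied = begin
        treeFact T V r * suc D   ≡⟨ cong (treeFact T V r *_) e[V]≡1+D ⟨
        treeFact T V r * e V     ≡⟨ *-comm (treeFact T V r) (e V) ⟩
        e V * treeFact T V r     ≡⟨ e[V]*treeFact≡n! ⟩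
        n !                      ≡⟨ weight*treeFacts≡n! ideal ⟨
        weight U * (treeFact T U r * treeFact T (V ─ U) r) ∎
      treeFacts≢0 : treeFact T U r * treeFact T (V ─ U) r ≢ 0
      treeFacts≢0 vanishes = ≢-nonZero⁻¹ (n !) {{n !≢0}} (trans (sym (weight*treeFacts≡n! ideal)) (trans (cong (weight U *_) vanishes) (*-zeroʳ (weight U))))

    foldr-treeBinom : ∀ L → foldr (λ U acc → if isSubtreeᵇ T r U then treeBinom T r U ℚ.+ acc else acc) ℚ.0ℚ L
                          ≡ sumₗ (map weight L) /1+ D
    foldr-treeBinom []      = sym (0/1+≡0 D)
    foldr-treeBinom (U ∷ L) with isSubtreeᵇ T r U in subtree
    ... | true  = trans (cong₂ ℚ._+_ (treeBinom≡weight U ideal) (foldr-treeBinom L)) (/1+-+ D (weight U) (sumₗ (map weight L)))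
      where ideal = Equivalence.to (subtree⇔ideal U) (Equivalence.from T-≡ subtree)
    ... | false = trans (foldr-treeBinom L) (cong (λ w → (w + sumₗ (map weight L)) /1+ D) (sym no-weight))
      where
      no-weight : weight U ≡ 0
      no-weight = cong (λ b → if b then (n C ∣ U ∣) * (e U * e (V ─ U)) else 0) (trans (sym (subtree≡ideal U)) subtree)

    sumBinom≡2^n : sumBinom T r ≡ (+ (2 ^ n)) / 1
    sumBinom≡2^n = begin
      sumBinom T r                          ≡⟨ foldr-treeBinom (allSubsets n) ⟩
      sumₗ (map weight (allSubsets n)) /1+ D ≡⟨ cong (_/1+ D) (trans (∑ₛ-allSubsets weight) ∑-weight≡2^n*e) ⟩
      (2 ^ n * e V) /1+ D                   ≡⟨ cong (λ x → (2 ^ n * x) /1+ D) e[V]≡1+D ⟩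
      (2 ^ n * suc D) /1+ D                 ≡⟨ *1+/1+≡ D (2 ^ n) ⟩
      (+ (2 ^ n)) / 1                       ∎
      where open ≡-Reasoning

mainTheorem11 : (n : ℕ) (r : Fin n) (T : Fin n → Fin n) → IsRootedTree T r →
    sumBinom T r ≡ (+ (2 ^ n)) / 1
mainTheorem11 n r T tree = RootedTree.sumBinom≡2^n T r tree
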